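{- For every set $X$, the structure $(\mathscr{M}(X),\cup,\cap,\cdot,\|,\emptyset,1_\sigma,1_\pi,U,\overline{1}_\pi)$ is a c-lattice.
   Context: For a set $X$, a multirelation over $X$ is a subset of $X\times 2^X$; $\mathscr{M}(X)$ is the set of all of them. Sequential composition: $R\cdot S=\{(a,A)\mid \exists B.\ (a,B)\in R\wedge \exists f.\ (\forall b\in B.\ (b,f(b))\in S)\wedge A=\bigcup_{b\in B} f(b)\}$. Parallel composition: $R\|S=\{(a,A\cup B)\mid (a,A)\in R\wedge (a,B)\in S\}$. Constants: $1_\sigma=\{(x,\{x\})\mid x\in X\}$, $1_\pi=\{(x,\emptyset)\mid x\in X\}$, $U=X\times 2^X$, $\overline{1}_\pi=U\setminus 1_\pi$. A proto-trioid is $(S,+,\cdot,\|,0,1_\sigma,1_\pi)$ where $(S,+,0)$ is a join semilattice with least element $0$ (order $x\le y\iff x+y=y$); $1_\sigma\cdot x=x=x\cdot 1_\sigma$; $x\cdot y+x\cdot z\le x\cdot(y+z)$; $(x+y)\cdot z=x\cdot z+y\cdot z$; $0\cdot x=0$; $\|$ is associative and commutative with unit $1_\pi$, distributes over $+$, and $0\|x=0$. A c-lattice is a structure $(S,+,\sqcap,\cdot,\|,0,1_\sigma,1_\pi,U,\overline{1}_\pi)$ such that $(S,+,\sqcap,0,U)$ is a bounded distributive lattice with least element $0$ and greatest element $U$, $(S,+,\cdot,\|,0,1_\sigma,1_\pi)$ is a proto-trioid, and for all $x,y,z$: (cl1) $x\cdot 1_\pi+x\cdot\overline{1}_\pi=x\cdot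 U$; (cl2) $1_\pi\sqcap(x+\overline{1}_\pi)=x\cdot 0$; (cl3) $x\cdot(y\|z)\le(x\cdot y)\|(x\cdot z)$; (cl4) $z\|z\le z\Rightarrow (x\|y)\cdot z=(x\cdot z)\|(y\cdot z)$; (cl5) $x\cdot(y\cdot(z\cdot 0))=(x\cdot y)\cdot(z\cdot 0)$; (cl6) $(x\cdot 0)\cdot y=x\cdot(0\cdot y)$; (cl7) $1_\sigma\|1_\sigma=1_\sigma$; (cl8) $((x\cdot 1_\pi)\|1_\sigma)\cdot y=(x\cdot 1_\pi)\|y$; (cl9) $((x\sqcap 1_\sigma)\cdot 1_\pi)\|1_\sigma=x\sqcap 1_\sigma$; (cl10) $((x\sqcap\overline{1}_\pi)\cdot 1_\pi)\|1_\sigma=1_\sigma\sqcap((x\sqcap\overline{1}_\pi)\cdot\overline{1}_\pi)$; (cl11) $((x\sqcap\overline{1}_\pi)\cdot 1_\pi)\|\overline{1}_\pi=(x\sqcap\overline{1}_\pi)\cdot\overline{1}_\pi$. -}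

module Defs where

open import Level using (Level; 0ℓ; _⊔_; Lift; lift; lower) renaming (suc to lsuc)
open import Data.Product using (Σ; Σ-syntax; _×_; _,_; proj₁; proj₂)
open import Data.Sum using (_⊎_; inj₁; inj₂)
open import Data.Unit using (⊤)
open import Data.Empty using (⊥)
open import Relation.Nullary using (¬_)
open import Relation.Binary using (Rel)
open import Relation.Unary using (Pred; _⊆_; _≐_; ∅; ｛_｝; _∪_)
open import Algebra.Core using (Op₂)
open import Algebra.Definitions using (_DistributesOver_)
open import Algebra.Structures using (IsIdempotentCommutativeMonoid; IsCommutativeMonoid)
open import Algebra.Lattice.Structures using (IsDistributiveLattice)

module _ {c ℓ : Level} {S : Set c} (_≈_ : Rel S ℓ) where

  record IsProtoTrioid (_+_ _·_ _∥_ : Op₂ S) (0# 1σ 1π : S) : Set (c ⊔ ℓ) where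
    _≤_ : Rel S ℓ
    x ≤ y = (x + y) ≈ y
    field
      +-isIdempotentCommutativeMonoid : IsIdempotentCommutativeMonoid _≈_ _+_ 0#
      ·-cong       : ∀ {x x′ y y′} → x ≈ x′ → y ≈ y′ → (x · y) ≈ (x′ · y′)
      ·-identityˡ  : ∀ x → (1σ · x) ≈ x
      ·-identityʳ  : ∀ x → (x · 1σ) ≈ x
      ·-subdistribˡ : ∀ x y z → ((x · y) + (x · z)) ≤ (x · (y + z))
      ·-distribʳ   : ∀ x y z → ((x + y) · z) ≈ ((x · z) + (y · z))
      ·-zeroˡ      : ∀ x → (0# · x) ≈ 0#
      ∥-isCommutativeMonoid : IsCommutativeMonoid _≈_ _∥_ 1π
      ∥-distrib-+  : _DistributesOver_ _≈_ _∥_ _+_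
      ∥-zeroˡ      : ∀ x → (0# ∥ x) ≈ 0#

  record IsCLattice (_+_ _⊓_ _·_ _∥_ : Op₂ S) (0# 1σ 1π U 1̄π : S) : Set (c ⊔ ℓ) where
    _≤_ : Rel S ℓ
    x ≤ y = (x + y) ≈ y
    field
      isDistributiveLattice : IsDistributiveLattice _≈_ _+_ _⊓_
      0-least      : ∀ x → 0# ≤ x
      U-greatest   : ∀ x → x ≤ U
      isProtoTrioid : IsProtoTrioid _+_ _·_ _∥_ 0# 1σ 1π
      cl1  : ∀ x → ((x · 1π) + (x · 1̄π)) ≈ (x · U)
      cl2  : ∀ x → (1π ⊓ (x + 1̄π)) ≈ (x · 0#)
      cl3  : ∀ x y z → (x · (y ∥ z)) ≤ ((x · y) ∥ (x · z))
      cl4  : ∀ x y z → (z ∥ z) ≤ z → ((x ∥ y) · z) ≈ ((x · z) ∥ (y · z))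
      cl5  : ∀ x y z → (x · (y · (z · 0#))) ≈ ((x · y) · (z · 0#))
      cl6  : ∀ x y → ((x · 0#) · y) ≈ (x · (0# · y))
      cl7  : (1σ ∥ 1σ) ≈ 1σ
      cl8  : ∀ x y → (((x · 1π) ∥ 1σ) · y) ≈ ((x · 1π) ∥ y)
      cl9  : ∀ x → (((x ⊓ 1σ) · 1π) ∥ 1σ) ≈ (x ⊓ 1σ)
      cl10 : ∀ x → (((x ⊓ 1̄π) · 1π) ∥ 1σ) ≈ (1σ ⊓ ((x ⊓ 1̄π) · 1̄π))
      cl11 : ∀ x → (((x ⊓ 1̄π) · 1π) ∥ 1̄π) ≈ ((x ⊓ 1̄π) · 1̄π)

-- Multirelations over a set X.
-- 2^X is rendered as Pred X 0ℓ with extensional equality _≐_; a subset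
-- of X × 2^X must therefore respect _≐_ in its second component.

module Multirel (X : Set) where

  PX : Set₁
  PX = Pred X 0ℓ

  ≐-trans : {A B C : PX} → A ≐ B → B ≐ C → A ≐ C
  ≐-trans (p , q) (r , s) = (λ z → r (p z)) , (λ z → q (s z))

  ≐-sym : {A B : PX} → A ≐ B → B ≐ A
  ≐-sym (p , q) = q , p

  record M : Set₂ where
    field
      rel  : X → PX → Set₁
      resp : ∀ {a A B} → A ≐ B → rel a A → rel a B
  open M public

  _≈_ : Rel M (lsuc 0ℓ)
  R ≈ S = ∀ a A → (rel R a A → rel S a A) × (rel S a A → rel R a A)

  ⋃∈ : PX → (X → PX) → PX
  ⋃∈ B f = λ x → Σ[ b ∈ X ] (B b × f b x)

  _∪ₘ_ : M → M → M
  rel  (R ∪ₘ S) a A = rel R a A ⊎ rel S a A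
  resp (R ∪ₘ S) e (inj₁ r) = inj₁ (resp R e r)
  resp (R ∪ₘ S) e (inj₂ s) = inj₂ (resp S e s)

  _∩ₘ_ : M → M → M
  rel  (R ∩ₘ S) a A = rel R a A × rel S a A
  resp (R ∩ₘ S) e (r , s) = resp R e r , resp S e s

  _·ₘ_ : M → M → M
  rel (R ·ₘ S) a A =
    Σ[ B ∈ PX ] (rel R a B × Σ[ f ∈ (X → PX) ] ((∀ b → B b → rel S b (f b)) × (A ≐ ⋃∈ B f)))
  resp (R ·ₘ S) e (B , r , f , h , e′) = B , r , f , h , ≐-trans (≐-sym e) e′

  _∥ₘ_ : M → M → M
  rel (R ∥ₘ S) a A = Σ[ B ∈ PX ] Σ[ C ∈ PX ] (rel R a B × rel S a C × (A ≐ (B ∪ C)))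
  resp (R ∥ₘ S) e (B , C , r , s , e′) = B , C , r , s , ≐-trans (≐-sym e) e′

  ∅ₘ : M
  rel  ∅ₘ _ _ = Lift _ ⊥
  resp ∅ₘ _ ()

  1σ : M
  rel  1σ a A = Lift _ (A ≐ ｛ a ｝)
  resp 1σ e (lift e′) = lift (≐-trans (≐-sym e) e′)

  1π : M
  rel  1π a A = Lift _ (A ≐ ∅)
  resp 1π e (lift e′) = lift (≐-trans (≐-sym e) e′)

  Uₘ : M
  rel  Uₘ _ _ = Lift _ ⊤
  resp Uₘ _ t = t

  1̄π : M
  rel  1̄π a A = Lift _ (¬ (A ≐ ∅))
  resp 1̄π e (lift n) = lift (λ e′ → n (≐-trans e e′))

-- Union, intersection, ∅ and U act pointwise on X × 2^X, so the distributive
-- lattice laws are inherited from the powerset of X × 2^X. For the other laws,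
-- the key observation is that a multirelation below 1π (such as x · 1π or x · 0)
-- relates only to ∅: composed on the left it absorbs whatever follows, and in
-- parallel it acts as a test on the input. Excluded middle is used to choose data for
-- each b ∈ B (a splitting of f b in cl3, an intermediate set in cl5), to merge
-- two families of z-related sets into one when z is closed under binary union
-- (cl4), and to decide whether a set is empty (cl1, cl10, cl11).

module Submission where

open import Defs
open import Level using (0ℓ; lift; lower) renaming (suc to lsuc)
open import Axiom.ExcludedMiddle using (ExcludedMiddle)
open import Data.Product using (Σ; Σ-syntax; _×_; _,_; proj₁; proj₂; uncurry)
open import Data.Sum using (_⊎_; inj₁; inj₂; [_,_])
open import Data.Unit using (tt)
open import Data.Empty using (⊥-elim)
open import Relation.Nullary using (¬_; Dec; yes; no)
open import Relation.Binary.PropositionalEquality using (refl)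
open import Relation.Binary.Bundles using (Setoid)
open import Relation.Unary using (Pred; _⊆_; _≐_; ∅; ｛_｝; _∪_)
open import Relation.Unary.Properties using (≐-refl)
open import Relation.Unary.Algebra
  using (∪-cong; ∪-comm; ∪-idem; ∪-assoc; ∪-∩-distributiveLattice; ∪-∩-isDistributiveLattice;
         ∪-monoid; ∪-isIdempotentCommutativeMonoid)
open import Algebra.Bundles using (Monoid; RawMonoid)
open import Algebra.Structures using (IsIdempotentCommutativeMonoid; IsCommutativeMonoid)
open import Algebra.Lattice.Bundles using (DistributiveLattice; RawLattice)
open import Algebra.Lattice.Structures using (IsDistributiveLattice)
open import Algebra.Morphism.Structures using (IsMonoidMonomorphism)
open import Algebra.Lattice.Morphism.Structures using (IsLatticeMonomorphism)
import Algebra.Morphism.MonoidMonomorphism as MonoidMonomorphism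
import Algebra.Lattice.Morphism.LatticeMonomorphism as LatticeMonomorphism
import Algebra.Consequences.Setoid as SetoidConsequences

module MultirelationAlgebra (X : Set) where
  open Multirel X

  ∪-identityˡ-≐∅ : {A B : PX} → A ≐ ∅ → (A ∪ B) ≐ B
  ∪-identityˡ-≐∅ (A⊆∅ , _) = (λ { (inj₁ x∈A) → ⊥-elim (A⊆∅ x∈A) ; (inj₂ x∈B) → x∈B }) , inj₂

  ∪-identityʳ-≐∅ : {A B : PX} → B ≐ ∅ → (A ∪ B) ≐ A
  ∪-identityʳ-≐∅ {A} {B} B≐∅ = ≐-trans (∪-comm A B) (∪-identityˡ-≐∅ B≐∅)

  ⋃∈-≐∅ : {B : PX} {f : X → PX} → (∀ b → B b → f b ≐ ∅) → ⋃∈ B f ≐ ∅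
  ⋃∈-≐∅ f≐∅ = (λ { (b , b∈B , x∈fb) → proj₁ (f≐∅ b b∈B) x∈fb }) , λ ()

  ⋃∈-｛｝ : {B : PX} {f : X → PX} {a : X} → B ≐ ｛ a ｝ → ⋃∈ B f ≐ f a
  ⋃∈-｛｝ {B} {f} {a} B≐a = ⊆fa , (λ x∈fa → a , proj₂ B≐a refl , x∈fa)
    where
    ⊆fa : ⋃∈ B f ⊆ f a
    ⊆fa (b , b∈B , x∈fb) with proj₁ B≐a b∈B
    ... | refl = x∈fb

  ⋃∈-singletons : {B : PX} {f : X → PX} → (∀ b → B b → f b ≐ ｛ b ｝) → ⋃∈ B f ≐ B
  ⋃∈-singletons {B} {f} f≐b = ⊆B , (λ {b} b∈B → b , b∈B , proj₂ (f≐b b b∈B) refl)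
    where
    ⊆B : ⋃∈ B f ⊆ B
    ⊆B (b , b∈B , x∈fb) with proj₁ (f≐b b b∈B) x∈fb
    ... | refl = b∈B

  ⋃∈-const : {B C : PX} → Σ X B → ⋃∈ B (λ _ → C) ≐ C
  ⋃∈-const (b , b∈B) = (λ { (_ , _ , x∈C) → x∈C }) , (λ x∈C → b , b∈B , x∈C)

  ⋃∈-∪-family : {B : PX} {f g k : X → PX} → (∀ b → B b → f b ≐ (g b ∪ k b)) →
                ⋃∈ B f ≐ (⋃∈ B g ∪ ⋃∈ B k)
  ⋃∈-∪-family {B} {f} {g} {k} f≐g∪k = ⊆∪ , ∪⊆
    where
    ⊆∪ : ⋃∈ B f ⊆ (⋃∈ B g ∪ ⋃∈ B k)
    ⊆∪ (b , b∈B , x∈fb) with proj₁ (f≐g∪k b b∈B) x∈fb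
    ... | inj₁ x∈gb = inj₁ (b , b∈B , x∈gb)
    ... | inj₂ x∈kb = inj₂ (b , b∈B , x∈kb)
    ∪⊆ : (⋃∈ B g ∪ ⋃∈ B k) ⊆ ⋃∈ B f
    ∪⊆ (inj₁ (b , b∈B , x∈gb)) = b , b∈B , proj₂ (f≐g∪k b b∈B) (inj₁ x∈gb)
    ∪⊆ (inj₂ (b , b∈B , x∈kb)) = b , b∈B , proj₂ (f≐g∪k b b∈B) (inj₂ x∈kb)

  ⋃∈-∪-index : {B B₁ B₂ : PX} {f : X → PX} → B ≐ (B₁ ∪ B₂) → ⋃∈ B f ≐ (⋃∈ B₁ f ∪ ⋃∈ B₂ f)
  ⋃∈-∪-index {B} {B₁} {B₂} {f} B≐B₁∪B₂ = ⊆∪ , ∪⊆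
    where
    ⊆∪ : ⋃∈ B f ⊆ (⋃∈ B₁ f ∪ ⋃∈ B₂ f)
    ⊆∪ (b , b∈B , x∈fb) with proj₁ B≐B₁∪B₂ b∈B
    ... | inj₁ b∈B₁ = inj₁ (b , b∈B₁ , x∈fb)
    ... | inj₂ b∈B₂ = inj₂ (b , b∈B₂ , x∈fb)
    ∪⊆ : (⋃∈ B₁ f ∪ ⋃∈ B₂ f) ⊆ ⋃∈ B f
    ∪⊆ (inj₁ (b , b∈B₁ , x∈fb)) = b , proj₂ B≐B₁∪B₂ (inj₁ b∈B₁) , x∈fb
    ∪⊆ (inj₂ (b , b∈B₂ , x∈fb)) = b , proj₂ B≐B₁∪B₂ (inj₂ b∈B₂) , x∈fb

  ⋃∈-∪-｛｝ : {A B : PX} {f : X → PX} {c : X} → A ≐ ⋃∈ B f → A c → A ≐ ⋃∈ B (λ b → f b ∪ ｛ c ｝)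
  ⋃∈-∪-｛｝ {A} {B} {f} {c} A≐⋃ c∈A = ⊆⋃ , ⋃⊆
    where
    ⊆⋃ : A ⊆ ⋃∈ B (λ b → f b ∪ ｛ c ｝)
    ⊆⋃ x∈A with proj₁ A≐⋃ x∈A
    ... | b , b∈B , x∈fb = b , b∈B , inj₁ x∈fb
    ⋃⊆ : ⋃∈ B (λ b → f b ∪ ｛ c ｝) ⊆ A
    ⋃⊆ (b , b∈B , inj₁ x∈fb) = proj₂ A≐⋃ (b , b∈B , x∈fb)
    ⋃⊆ (b , b∈B , inj₂ refl) = c∈A

  guard : Set → PX → PX
  guard P E x = P × E x

  guard-yes : {P : Set} {E : PX} → P → guard P E ≐ E
  guard-yes p = proj₂ , (λ x∈E → p , x∈E)

  guard-no : {P : Set} {E : PX} → ¬ P → guard P E ≐ ∅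
  guard-no ¬p = (λ { (p , _) → ¬p p }) , λ ()

  ⋃∈-guard : {B₁ B₂ : PX} {f₁ f₂ : X → PX} →
             (⋃∈ B₁ f₁ ∪ ⋃∈ B₂ f₂) ≐ ⋃∈ (B₁ ∪ B₂) (λ b → guard (B₁ b) (f₁ b) ∪ guard (B₂ b) (f₂ b))
  ⋃∈-guard =
      (λ { (inj₁ (b , b∈B₁ , x∈f₁b)) → b , inj₁ b∈B₁ , inj₁ (b∈B₁ , x∈f₁b)
         ; (inj₂ (b , b∈B₂ , x∈f₂b)) → b , inj₂ b∈B₂ , inj₂ (b∈B₂ , x∈f₂b) })
    , (λ { (b , _ , inj₁ (b∈B₁ , x∈f₁b)) → inj₁ (b , b∈B₁ , x∈f₁b)
         ; (b , _ , inj₂ (b∈B₂ , x∈f₂b)) → inj₂ (b , b∈B₂ , x∈f₂b) })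

  ⟦_⟧ : M → Pred (X × PX) (lsuc 0ℓ)
  ⟦ R ⟧ = uncurry (rel R)

  ⟦⟧-cong : ∀ {R S} → R ≈ S → ⟦ R ⟧ ≐ ⟦ S ⟧
  ⟦⟧-cong R≈S = (λ {p} → proj₁ (R≈S (proj₁ p) (proj₂ p)))
              , (λ {p} → proj₂ (R≈S (proj₁ p) (proj₂ p)))

  ⟦⟧-injective : ∀ {R S} → ⟦ R ⟧ ≐ ⟦ S ⟧ → R ≈ S
  ⟦⟧-injective (R⊆S , S⊆R) a A = R⊆S , S⊆R

  ∪ₘ-∩ₘ-rawLattice : RawLattice _ _
  ∪ₘ-∩ₘ-rawLattice = record { _≈_ = _≈_ ; _∨_ = _∪ₘ_ ; _∧_ = _∩ₘ_ }

  ∪ₘ-rawMonoid : RawMonoid _ _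
  ∪ₘ-rawMonoid = record { _≈_ = _≈_ ; _∙_ = _∪ₘ_ ; ε = ∅ₘ }

  ⟦⟧-isLatticeMonomorphism : IsLatticeMonomorphism ∪ₘ-∩ₘ-rawLattice
    (DistributiveLattice.rawLattice (∪-∩-distributiveLattice (X × PX) (lsuc 0ℓ))) ⟦_⟧
  ⟦⟧-isLatticeMonomorphism = record
    { isLatticeHomomorphism = record
      { isRelHomomorphism = record { cong = λ {R} {S} → ⟦⟧-cong {R} {S} }
      ; ∧-homo = λ _ _ → ≐-refl
      ; ∨-homo = λ _ _ → ≐-refl }
    ; injective = λ {R} {S} → ⟦⟧-injective {R} {S} }

  ⟦⟧-isMonoidMonomorphism : IsMonoidMonomorphism ∪ₘ-rawMonoid
    (Monoid.rawMonoid (∪-monoid (X × PX) (lsuc 0ℓ))) ⟦_⟧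
  ⟦⟧-isMonoidMonomorphism = record
    { isMonoidHomomorphism = record
      { isMagmaHomomorphism = record
        { isRelHomomorphism = record { cong = λ {R} {S} → ⟦⟧-cong {R} {S} }
        ; homo = λ _ _ → ≐-refl }
      ; ε-homo = ≐-refl }
    ; injective = λ {R} {S} → ⟦⟧-injective {R} {S} }

  ∪ₘ-∩ₘ-isDistributiveLattice : IsDistributiveLattice _≈_ _∪ₘ_ _∩ₘ_
  ∪ₘ-∩ₘ-isDistributiveLattice = LatticeMonomorphism.isDistributiveLattice ⟦⟧-isLatticeMonomorphism
    (∪-∩-isDistributiveLattice (X × PX) (lsuc 0ℓ))

  ∪ₘ-isIdempotentCommutativeMonoid : IsIdempotentCommutativeMonoid _≈_ _∪ₘ_ ∅ₘ
  ∪ₘ-isIdempotentCommutativeMonoid = record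
    { isCommutativeMonoid = MonoidMonomorphism.isCommutativeMonoid ⟦⟧-isMonoidMonomorphism
        (IsIdempotentCommutativeMonoid.isCommutativeMonoid ∪ICM)
    ; idem = MonoidMonomorphism.idem ⟦⟧-isMonoidMonomorphism
        (IsIdempotentCommutativeMonoid.isMagma ∪ICM) (IsIdempotentCommutativeMonoid.idem ∪ICM) }
    where ∪ICM = ∪-isIdempotentCommutativeMonoid (X × PX) (lsuc 0ℓ)

  open IsDistributiveLattice ∪ₘ-∩ₘ-isDistributiveLattice
    using (isEquivalence)
    renaming (refl to ≈-refl; sym to ≈-sym; trans to ≈-trans; ∨-cong to ∪ₘ-cong)

  ≈-setoid : Setoid _ _
  ≈-setoid = record { isEquivalence = isEquivalence }

  _⊑_ : M → M → Set₁
  R ⊑ S = ∀ {a A} → rel R a A → rel S a A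

  ⊑-antisym : ∀ {R S} → R ⊑ S → S ⊑ R → R ≈ S
  ⊑-antisym R⊑S S⊑R a A = R⊑S , S⊑R

  ≈⇒⊑ : ∀ {R S} → R ≈ S → R ⊑ S
  ≈⇒⊑ R≈S {a} {A} = proj₁ (R≈S a A)

  ≈⇒⊒ : ∀ {R S} → R ≈ S → S ⊑ R
  ≈⇒⊒ R≈S {a} {A} = proj₂ (R≈S a A)

  ∪ₘ-lub : ∀ {R S T} → R ⊑ T → S ⊑ T → (R ∪ₘ S) ⊑ T
  ∪ₘ-lub R⊑T S⊑T (inj₁ r) = R⊑T r
  ∪ₘ-lub R⊑T S⊑T (inj₂ s) = S⊑T s

  ⊑⇒≤ : ∀ {R S} → R ⊑ S → (R ∪ₘ S) ≈ S
  ⊑⇒≤ {R} {S} R⊑S = ⊑-antisym {R ∪ₘ S} {S} (∪ₘ-lub {R} {S} {S} R⊑S (λ s → s)) inj₂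

  ·-mono-⊑ : ∀ {R R′ S S′} → R ⊑ R′ → S ⊑ S′ → (R ·ₘ S) ⊑ (R′ ·ₘ S′)
  ·-mono-⊑ R⊑R′ S⊑S′ (B , r , f , s , A≐⋃) = B , R⊑R′ r , f , (λ b b∈B → S⊑S′ (s b b∈B)) , A≐⋃

  ·-cong : ∀ {R R′ S S′} → R ≈ R′ → S ≈ S′ → (R ·ₘ S) ≈ (R′ ·ₘ S′)
  ·-cong {R} {R′} {S} {S′} R≈R′ S≈S′ = ⊑-antisym {R ·ₘ S} {R′ ·ₘ S′}
    (·-mono-⊑ {R} {R′} {S} {S′} (≈⇒⊑ {R} {R′} R≈R′) (≈⇒⊑ {S} {S′} S≈S′))
    (·-mono-⊑ {R′} {R} {S′} {S} (≈⇒⊒ {R} {R′} R≈R′) (≈⇒⊒ {S} {S′} S≈S′))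

  ·-intro-｛｝ : ∀ {R S a A} → rel R a ｛ a ｝ → rel S a A → rel (R ·ₘ S) a A
  ·-intro-｛｝ {a = a} r s = ｛ a ｝ , r , (λ _ → _) , (λ { _ refl → s }) , ≐-sym (⋃∈-｛｝ ≐-refl)

  ·-elim-｛｝ : ∀ {S a A B f} → B ≐ ｛ a ｝ → (∀ b → B b → rel S b (f b)) → A ≐ ⋃∈ B f → rel S a A
  ·-elim-｛｝ {S} B≐a s A≐⋃ = resp S (≐-sym (≐-trans A≐⋃ (⋃∈-｛｝ B≐a))) (s _ (proj₂ B≐a refl))

  ·-intro-≐∅ : ∀ {R S a A} → rel R a A → A ≐ ∅ → rel (R ·ₘ S) a A
  ·-intro-≐∅ r A≐∅ =
    _ , r , (λ _ → ∅) , (λ b b∈A → ⊥-elim (proj₁ A≐∅ b∈A))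
    , ≐-trans A≐∅ (≐-sym (⋃∈-≐∅ (λ _ _ → ≐-refl)))

  ·-identityˡ : ∀ R → (1σ ·ₘ R) ≈ R
  ·-identityˡ R = ⊑-antisym {1σ ·ₘ R} {R}
    (λ { (B , lift B≐a , f , r , A≐⋃) → ·-elim-｛｝ {R} B≐a r A≐⋃ })
    (·-intro-｛｝ {1σ} {R} (lift ≐-refl))

  ·-identityʳ : ∀ R → (R ·ₘ 1σ) ≈ R
  ·-identityʳ R = ⊑-antisym {R ·ₘ 1σ} {R}
    (λ { (B , r , f , h , A≐⋃) →
           resp R (≐-sym (≐-trans A≐⋃ (⋃∈-singletons (λ b b∈B → lower (h b b∈B))))) r })
    (λ r → _ , r , ｛_｝ , (λ _ _ → lift ≐-refl) , ≐-sym (⋃∈-singletons (λ _ _ → ≐-refl)))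

  ·-distribʳ : ∀ R S T → ((R ∪ₘ S) ·ₘ T) ≈ ((R ·ₘ T) ∪ₘ (S ·ₘ T))
  ·-distribʳ R S T = ⊑-antisym {(R ∪ₘ S) ·ₘ T} {(R ·ₘ T) ∪ₘ (S ·ₘ T)}
    (λ { (B , inj₁ r , rest) → inj₁ (B , r , rest) ; (B , inj₂ s , rest) → inj₂ (B , s , rest) })
    (λ { (inj₁ (B , r , rest)) → B , inj₁ r , rest ; (inj₂ (B , s , rest)) → B , inj₂ s , rest })

  ·-zeroˡ : ∀ R → (∅ₘ ·ₘ R) ≈ ∅ₘ
  ·-zeroˡ R = ⊑-antisym {∅ₘ ·ₘ R} {∅ₘ} (λ { (_ , lift () , _) }) (λ { (lift ()) })

  ·-⊑1π : ∀ {R W} → W ⊑ 1π → (R ·ₘ W) ⊑ 1π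
  ·-⊑1π W⊑1π (B , _ , f , w , A≐⋃) = lift (≐-trans A≐⋃ (⋃∈-≐∅ (λ b b∈B → lower (W⊑1π (w b b∈B)))))

  ·1π-⊑1π : ∀ R → (R ·ₘ 1π) ⊑ 1π
  ·1π-⊑1π R = ·-⊑1π {R} {1π} (λ e → e)

  ·1π-intro : ∀ {R a B} → rel R a B → rel (R ·ₘ 1π) a ∅
  ·1π-intro r = _ , r , (λ _ → ∅) , (λ _ _ → lift ≐-refl) , ≐-sym (⋃∈-≐∅ (λ _ _ → ≐-refl))

  ⊑1π⇒·-zeroˡ : ∀ {W} → W ⊑ 1π → ∀ S → (W ·ₘ S) ≈ W
  ⊑1π⇒·-zeroˡ {W} W⊑1π S = ⊑-antisym {W ·ₘ S} {W}
    (λ { (B , w , f , _ , A≐⋃) →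
           let B≐∅ = lower (W⊑1π w)
               A≐∅ = ≐-trans A≐⋃ (⋃∈-≐∅ (λ b b∈B → ⊥-elim (proj₁ B≐∅ b∈B))) in
           resp W (≐-trans B≐∅ (≐-sym A≐∅)) w })
    (λ w → ·-intro-≐∅ {W} {S} w (lower (W⊑1π w)))

  ·∅ₘ-elim : ∀ {R a A} → rel (R ·ₘ ∅ₘ) a A → rel R a A × A ≐ ∅
  ·∅ₘ-elim {R} {A = A} (B , r , f , h , A≐⋃) = resp R (≐-trans B≐∅ (≐-sym A≐∅)) r , A≐∅
    where
    B≐∅ : B ≐ ∅
    B≐∅ = (λ b∈B → lower (h _ b∈B)) , λ ()
    A≐∅ : A ≐ ∅
    A≐∅ = ≐-trans A≐⋃ (⋃∈-≐∅ (λ b b∈B → ⊥-elim (lower (h b b∈B))))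

  ∥-cong : ∀ {R R′ S S′} → R ≈ R′ → S ≈ S′ → (R ∥ₘ S) ≈ (R′ ∥ₘ S′)
  ∥-cong R≈R′ S≈S′ a A =
      (λ { (B , C , r , s , A≐B∪C) → B , C , proj₁ (R≈R′ a B) r , proj₁ (S≈S′ a C) s , A≐B∪C })
    , (λ { (B , C , r , s , A≐B∪C) → B , C , proj₂ (R≈R′ a B) r , proj₂ (S≈S′ a C) s , A≐B∪C })

  ∥-assoc : ∀ R S T → ((R ∥ₘ S) ∥ₘ T) ≈ (R ∥ₘ (S ∥ₘ T))
  ∥-assoc R S T = ⊑-antisym {(R ∥ₘ S) ∥ₘ T} {R ∥ₘ (S ∥ₘ T)}
    (λ { (D , E , (B , C , r , s , D≐B∪C) , t , A≐D∪E) →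
           B , C ∪ E , r , (C , E , s , t , ≐-refl)
           , ≐-trans A≐D∪E (≐-trans (∪-cong D≐B∪C ≐-refl) (∪-assoc B C E)) })
    (λ { (B , D , r , (C , E , s , t , D≐C∪E) , A≐B∪D) →
           B ∪ C , E , (B , C , r , s , ≐-refl) , t
           , ≐-trans A≐B∪D (≐-trans (∪-cong ≐-refl D≐C∪E) (≐-sym (∪-assoc B C E))) })

  ∥-comm : ∀ R S → (R ∥ₘ S) ≈ (S ∥ₘ R)
  ∥-comm R S = ⊑-antisym {R ∥ₘ S} {S ∥ₘ R} (swap {R} {S}) (swap {S} {R})
    where
    swap : ∀ {R S} → (R ∥ₘ S) ⊑ (S ∥ₘ R)
    swap (B , C , r , s , A≐B∪C) = C , B , s , r , ≐-trans A≐B∪C (∪-comm B C)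

  ∥-intro-∅ : ∀ {T S a A} → rel T a ∅ → rel S a A → rel (T ∥ₘ S) a A
  ∥-intro-∅ t s = ∅ , _ , t , s , ≐-sym (∪-identityˡ-≐∅ ≐-refl)

  ⊑1π⇒∥-elim : ∀ {T S a A} → T ⊑ 1π → rel (T ∥ₘ S) a A → rel T a ∅ × rel S a A
  ⊑1π⇒∥-elim {T} {S} T⊑1π (B , C , t , s , A≐B∪C) =
    resp T B≐∅ t , resp S (≐-sym (≐-trans A≐B∪C (∪-identityˡ-≐∅ B≐∅))) s
    where B≐∅ = lower (T⊑1π t)

  ∥-identityˡ : ∀ S → (1π ∥ₘ S) ≈ S
  ∥-identityˡ S = ⊑-antisym {1π ∥ₘ S} {S}
    (λ p → proj₂ (⊑1π⇒∥-elim {1π} {S} (λ e → e) p))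
    (∥-intro-∅ {1π} {S} (lift ≐-refl))

  ∥-distribˡ : ∀ R S T → (R ∥ₘ (S ∪ₘ T)) ≈ ((R ∥ₘ S) ∪ₘ (R ∥ₘ T))
  ∥-distribˡ R S T = ⊑-antisym {R ∥ₘ (S ∪ₘ T)} {(R ∥ₘ S) ∪ₘ (R ∥ₘ T)}
    (λ { (B , C , r , inj₁ s , A≐B∪C) → inj₁ (B , C , r , s , A≐B∪C)
       ; (B , C , r , inj₂ t , A≐B∪C) → inj₂ (B , C , r , t , A≐B∪C) })
    (λ { (inj₁ (B , C , r , s , A≐B∪C)) → B , C , r , inj₁ s , A≐B∪C
       ; (inj₂ (B , C , r , t , A≐B∪C)) → B , C , r , inj₂ t , A≐B∪C })

  ∥-zeroˡ : ∀ R → (∅ₘ ∥ₘ R) ≈ ∅ₘ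
  ∥-zeroˡ R = ⊑-antisym {∅ₘ ∥ₘ R} {∅ₘ} (λ { (_ , _ , lift () , _) }) (λ { (lift ()) })

  open SetoidConsequences ≈-setoid using (comm∧idˡ⇒id; comm∧distrˡ⇒distr)

  ∥-isCommutativeMonoid : IsCommutativeMonoid _≈_ _∥ₘ_ 1π
  ∥-isCommutativeMonoid = record
    { isMonoid = record
      { isSemigroup = record
        { isMagma = record
          { isEquivalence = isEquivalence
          ; ∙-cong = λ {R} {R′} {S} {S′} → ∥-cong {R} {R′} {S} {S′} }
        ; assoc = ∥-assoc }
      ; identity = comm∧idˡ⇒id {_∙_ = _∥ₘ_} ∥-comm {1π} ∥-identityˡ }
    ; comm = ∥-comm }

  ∪ₘ-∥ₘ-isProtoTrioid : IsProtoTrioid _≈_ _∪ₘ_ _·ₘ_ _∥ₘ_ ∅ₘ 1σ 1π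
  ∪ₘ-∥ₘ-isProtoTrioid = record
    { +-isIdempotentCommutativeMonoid = ∪ₘ-isIdempotentCommutativeMonoid
    ; ·-cong = λ {R} {R′} {S} {S′} → ·-cong {R} {R′} {S} {S′}
    ; ·-identityˡ = ·-identityˡ
    ; ·-identityʳ = ·-identityʳ
    ; ·-subdistribˡ = λ R S T → ⊑⇒≤ {(R ·ₘ S) ∪ₘ (R ·ₘ T)} {R ·ₘ (S ∪ₘ T)}
        (∪ₘ-lub {R ·ₘ S} {R ·ₘ T} {R ·ₘ (S ∪ₘ T)}
          (·-mono-⊑ {R} {R} {S} {S ∪ₘ T} (λ r → r) inj₁)
          (·-mono-⊑ {R} {R} {T} {S ∪ₘ T} (λ r → r) inj₂))
    ; ·-distribʳ = ·-distribʳ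
    ; ·-zeroˡ = ·-zeroˡ
    ; ∥-isCommutativeMonoid = ∥-isCommutativeMonoid
    ; ∥-distrib-+ = comm∧distrˡ⇒distr {_∙_ = _∥ₘ_} {_∪ₘ_}
        (λ {R} {R′} {S} {S′} → ∪ₘ-cong {R} {R′} {S} {S′}) ∥-comm ∥-distribˡ
    ; ∥-zeroˡ = ∥-zeroˡ }

  1π-∩-∪-1̄π : ∀ R → (1π ∩ₘ (R ∪ₘ 1̄π)) ≈ (R ·ₘ ∅ₘ)
  1π-∩-∪-1̄π R = ⊑-antisym {1π ∩ₘ (R ∪ₘ 1̄π)} {R ·ₘ ∅ₘ}
    (λ { (lift A≐∅ , inj₁ r) → ·-intro-≐∅ {R} {∅ₘ} r A≐∅
       ; (lift A≐∅ , inj₂ (lift A≉∅)) → ⊥-elim (A≉∅ A≐∅) })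
    (λ p → let (r , A≐∅) = ·∅ₘ-elim {R} p in lift A≐∅ , inj₁ r)

  ·∅ₘ-·-assoc : ∀ R S → ((R ·ₘ ∅ₘ) ·ₘ S) ≈ (R ·ₘ (∅ₘ ·ₘ S))
  ·∅ₘ-·-assoc R S = ≈-trans {(R ·ₘ ∅ₘ) ·ₘ S} {R ·ₘ ∅ₘ} {R ·ₘ (∅ₘ ·ₘ S)}
    (⊑1π⇒·-zeroˡ {R ·ₘ ∅ₘ} (·-⊑1π {R} {∅ₘ} (λ { (lift ()) })) S)
    (·-cong {R} {R} {∅ₘ} {∅ₘ ·ₘ S} (≈-refl {R}) (≈-sym {∅ₘ ·ₘ S} {∅ₘ} (·-zeroˡ S)))

  1σ-∥-idem : (1σ ∥ₘ 1σ) ≈ 1σ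
  1σ-∥-idem = ⊑-antisym {1σ ∥ₘ 1σ} {1σ}
    (λ { (B , C , lift B≐a , lift C≐a , A≐B∪C) →
           lift (≐-trans A≐B∪C (≐-trans (∪-cong B≐a C≐a) (∪-idem _))) })
    (λ { {A = A} (lift A≐a) → A , A , lift A≐a , lift A≐a , ≐-sym (∪-idem A) })

  ⊑1π⇒∥1σ-· : ∀ {T} → T ⊑ 1π → ∀ S → ((T ∥ₘ 1σ) ·ₘ S) ≈ (T ∥ₘ S)
  ⊑1π⇒∥1σ-· {T} T⊑1π S = ⊑-antisym {(T ∥ₘ 1σ) ·ₘ S} {T ∥ₘ S}
    (λ { (B , p , f , s , A≐⋃) →
           let (t , lift B≐a) = ⊑1π⇒∥-elim {T} {1σ} T⊑1π p in
           ∥-intro-∅ {T} {S} t (·-elim-｛｝ {S} B≐a s A≐⋃) })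
    (λ p → let (t , s) = ⊑1π⇒∥-elim {T} {S} T⊑1π p in
           ·-intro-｛｝ {T ∥ₘ 1σ} {S} (∥-intro-∅ {T} {1σ} t (lift ≐-refl)) s)

  ∩1σ-·1π-∥-1σ : ∀ R → (((R ∩ₘ 1σ) ·ₘ 1π) ∥ₘ 1σ) ≈ (R ∩ₘ 1σ)
  ∩1σ-·1π-∥-1σ R = ⊑-antisym {((R ∩ₘ 1σ) ·ₘ 1π) ∥ₘ 1σ} {R ∩ₘ 1σ}
    (λ p →
       let ((B , (r , lift B≐a) , _) , lift A≐a) =
             ⊑1π⇒∥-elim {(R ∩ₘ 1σ) ·ₘ 1π} {1σ} (·1π-⊑1π (R ∩ₘ 1σ)) p in
       resp R (≐-trans B≐a (≐-sym A≐a)) r , lift A≐a)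
    (λ { (r , lift A≐a) →
           ∥-intro-∅ {(R ∩ₘ 1σ) ·ₘ 1π} {1σ} (·1π-intro {R ∩ₘ 1σ} (r , lift A≐a)) (lift A≐a) })

  module _ (em : ExcludedMiddle 0ℓ) where

    ≐∅⊎inhabited : (E : PX) → E ≐ ∅ ⊎ Σ X E
    ≐∅⊎inhabited E with em {Σ X E}
    ... | yes e = inj₂ e
    ... | no ¬e = inj₁ ((λ {x} x∈E → ¬e (x , x∈E)) , λ ())

    inhabited : {E : PX} → ¬ (E ≐ ∅) → Σ X E
    inhabited {E} E≉∅ with ≐∅⊎inhabited E
    ... | inj₁ E≐∅ = ⊥-elim (E≉∅ E≐∅)
    ... | inj₂ e = e

    -- Deciding B b makes the chosen value independent of the proof of B b.
    choose : {A : Set₁} → A → {B : PX} {Q : X → A → Set₁} →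
             (∀ b → B b → Σ A (Q b)) → Σ[ f ∈ (X → A) ] (∀ b → B b → Q b (f b))
    choose {A} a₀ {B} {Q} pick = (λ b → chosen b em) , (λ b → chosen-spec b em)
      where
      chosen : (b : X) → Dec (B b) → A
      chosen b (yes b∈B) = proj₁ (pick b b∈B)
      chosen b (no _) = a₀
      chosen-spec : ∀ b (d : Dec (B b)) → B b → Q b (chosen b d)
      chosen-spec b (yes b∈B) _ = proj₂ (pick b b∈B)
      chosen-spec b (no b∉B) b∈B = ⊥-elim (b∉B b∈B)

    ·Uₘ⊑·1π∪·1̄π : ∀ R → (R ·ₘ Uₘ) ⊑ ((R ·ₘ 1π) ∪ₘ (R ·ₘ 1̄π))
    ·Uₘ⊑·1π∪·1̄π R {A = A} (B , r , f , _ , A≐⋃) with ≐∅⊎inhabited A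
    ... | inj₁ A≐∅ = inj₁ (resp (R ·ₘ 1π) (≐-sym A≐∅) (·1π-intro {R} r))
    ... | inj₂ (c , c∈A) =
      inj₂ (B , r , (λ b → f b ∪ ｛ c ｝) , (λ _ _ → lift (λ fb∪c≐∅ → proj₁ fb∪c≐∅ (inj₂ refl)))
           , ⋃∈-∪-｛｝ A≐⋃ c∈A)

    ·1π-∪-·1̄π : ∀ R → ((R ·ₘ 1π) ∪ₘ (R ·ₘ 1̄π)) ≈ (R ·ₘ Uₘ)
    ·1π-∪-·1̄π R = ⊑-antisym {(R ·ₘ 1π) ∪ₘ (R ·ₘ 1̄π)} {R ·ₘ Uₘ}
      (∪ₘ-lub {R ·ₘ 1π} {R ·ₘ 1̄π} {R ·ₘ Uₘ}
        (·-mono-⊑ {R} {R} {1π} {Uₘ} (λ r → r) (λ _ → lift tt))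
        (·-mono-⊑ {R} {R} {1̄π} {Uₘ} (λ r → r) (λ _ → lift tt)))
      (·Uₘ⊑·1π∪·1̄π R)

    ·-subdistribˡ-∥ : ∀ R S T → (R ·ₘ (S ∥ₘ T)) ⊑ ((R ·ₘ S) ∥ₘ (R ·ₘ T))
    ·-subdistribˡ-∥ R S T (B , r , f , st , A≐⋃) =
      ⋃∈ B g , ⋃∈ B k , (B , r , g , s , ≐-refl) , (B , r , k , t , ≐-refl)
      , ≐-trans A≐⋃ (⋃∈-∪-family f≐g∪k)
      where
      Split : X → PX × PX → Set₁
      Split b GK = rel S b (proj₁ GK) × rel T b (proj₂ GK) × f b ≐ (proj₁ GK ∪ proj₂ GK)
      split : Σ[ gk ∈ (X → PX × PX) ] (∀ b → B b → Split b (gk b))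
      split = choose (∅ , ∅) {B} {Split}
        (λ b b∈B → let (G , K , s , t , fb≐G∪K) = st b b∈B in (G , K) , s , t , fb≐G∪K)
      g k : X → PX
      g b = proj₁ (proj₁ split b)
      k b = proj₂ (proj₁ split b)
      s : ∀ b → B b → rel S b (g b)
      s b b∈B = proj₁ (proj₂ split b b∈B)
      t : ∀ b → B b → rel T b (k b)
      t b b∈B = proj₁ (proj₂ (proj₂ split b b∈B))
      f≐g∪k : ∀ b → B b → f b ≐ (g b ∪ k b)
      f≐g∪k b b∈B = proj₂ (proj₂ (proj₂ split b b∈B))

    ∪-closed : M → Set₁
    ∪-closed Z = ∀ {b E F} → rel Z b E → rel Z b F → rel Z b (E ∪ F)

    ∥-self≤⇒∪-closed : ∀ Z → ((Z ∥ₘ Z) ∪ₘ Z) ≈ Z → ∪-closed Z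
    ∥-self≤⇒∪-closed Z Z∥Z≤Z {b} {E} {F} e f =
      proj₁ (Z∥Z≤Z b (E ∪ F)) (inj₁ (E , F , e , f , ≐-refl))

    guard-∪-rel : ∀ {Z} → ∪-closed Z → ∀ {b P Q E F} → P ⊎ Q →
                  (P → rel Z b E) → (Q → rel Z b F) → rel Z b (guard P E ∪ guard Q F)
    guard-∪-rel {Z} Z-closed {P = P} {Q} p⊎q e f with em {P} | em {Q}
    ... | yes p | yes q = resp Z (≐-sym (∪-cong (guard-yes p) (guard-yes q))) (Z-closed (e p) (f q))
    ... | yes p | no ¬q =
      resp Z (≐-sym (≐-trans (∪-cong (guard-yes p) ≐-refl) (∪-identityʳ-≐∅ (guard-no ¬q)))) (e p)
    ... | no ¬p | yes q =
      resp Z (≐-sym (≐-trans (∪-identityˡ-≐∅ (guard-no ¬p)) (guard-yes q))) (f q)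
    ... | no ¬p | no ¬q = ⊥-elim ([ ¬p , ¬q ] p⊎q)

    ·-distribʳ-∥ : ∀ R S Z → ∪-closed Z → ((R ∥ₘ S) ·ₘ Z) ≈ ((R ·ₘ Z) ∥ₘ (S ·ₘ Z))
    ·-distribʳ-∥ R S Z Z-closed = ⊑-antisym {(R ∥ₘ S) ·ₘ Z} {(R ·ₘ Z) ∥ₘ (S ·ₘ Z)}
      (λ { (B , (B₁ , B₂ , r , s , B≐B₁∪B₂) , f , z , A≐⋃) →
             ⋃∈ B₁ f , ⋃∈ B₂ f
             , (B₁ , r , f , (λ b b∈B₁ → z b (proj₂ B≐B₁∪B₂ (inj₁ b∈B₁))) , ≐-refl)
             , (B₂ , s , f , (λ b b∈B₂ → z b (proj₂ B≐B₁∪B₂ (inj₂ b∈B₂))) , ≐-refl)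
             , ≐-trans A≐⋃ (⋃∈-∪-index B≐B₁∪B₂) })
      -- Where both families are defined, their union is Z-related because Z is ∪-closed.
      (λ { (A₁ , A₂ , (B₁ , r , f₁ , z₁ , A₁≐⋃) , (B₂ , s , f₂ , z₂ , A₂≐⋃) , A≐A₁∪A₂) →
             B₁ ∪ B₂ , (B₁ , B₂ , r , s , ≐-refl)
             , (λ b → guard (B₁ b) (f₁ b) ∪ guard (B₂ b) (f₂ b))
             , (λ b b∈B₁∪B₂ → guard-∪-rel {Z} Z-closed b∈B₁∪B₂ (z₁ b) (z₂ b))
             , ≐-trans A≐A₁∪A₂ (≐-trans (∪-cong A₁≐⋃ A₂≐⋃) ⋃∈-guard) })

    ⊑1π⇒·-assoc : ∀ {W} → W ⊑ 1π → ∀ R S → (R ·ₘ (S ·ₘ W)) ≈ ((R ·ₘ S) ·ₘ W)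
    ⊑1π⇒·-assoc {W} W⊑1π R S = ⊑-antisym {R ·ₘ (S ·ₘ W)} {(R ·ₘ S) ·ₘ W} ⊑assoc ⊒assoc
      where
      W-∅ : ∀ {b E} → rel W b E → rel W b ∅
      W-∅ w = resp W (lower (W⊑1π w)) w
      ⋃∈const∅ : {B : PX} → ∅ ≐ ⋃∈ B (λ _ → ∅)
      ⋃∈const∅ = ≐-sym (⋃∈-≐∅ (λ _ _ → ≐-refl))
      -- Both sides relate only to ∅, so only the intermediate sets D c have to be chosen.
      ⊑assoc : (R ·ₘ (S ·ₘ W)) ⊑ ((R ·ₘ S) ·ₘ W)
      ⊑assoc p@(C , r , g , sw , _) =
        ⋃∈ C D , (C , r , D , s , ≐-refl) , (λ _ → ∅) , (λ { b (c , c∈C , b∈Dc) → w c c∈C b b∈Dc })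
        , ≐-trans (lower (·-⊑1π {R} {S ·ₘ W} (·-⊑1π {S} {W} W⊑1π) p)) ⋃∈const∅
        where
        Step : X → PX → Set₁
        Step c D = rel S c D × (∀ b → D b → rel W b ∅)
        step : Σ[ D ∈ (X → PX) ] (∀ c → C c → Step c (D c))
        step = choose ∅ {C} {Step}
          (λ c c∈C → let (D , s , _ , w , _) = sw c c∈C in D , s , (λ b b∈D → W-∅ (w b b∈D)))
        D = proj₁ step
        s : ∀ c → C c → rel S c (D c)
        s c c∈C = proj₁ (proj₂ step c c∈C)
        w : ∀ c → C c → ∀ b → D c b → rel W b ∅
        w c c∈C = proj₂ (proj₂ step c c∈C)
      ⊒assoc : ((R ·ₘ S) ·ₘ W) ⊑ (R ·ₘ (S ·ₘ W))
      ⊒assoc p@(B , (C , r , g , s , B≐⋃) , _ , w , _) =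
        C , r , (λ _ → ∅)
        , (λ c c∈C → g c , s c c∈C , (λ _ → ∅)
                     , (λ b b∈gc → W-∅ (w b (proj₂ B≐⋃ (c , c∈C , b∈gc)))) , ⋃∈const∅)
        , ≐-trans (lower (·-⊑1π {R ·ₘ S} {W} W⊑1π p)) ⋃∈const∅

    ∩1̄π-·1π-∥-1σ : ∀ R → (((R ∩ₘ 1̄π) ·ₘ 1π) ∥ₘ 1σ) ≈ (1σ ∩ₘ ((R ∩ₘ 1̄π) ·ₘ 1̄π))
    ∩1̄π-·1π-∥-1σ R = ⊑-antisym {((R ∩ₘ 1̄π) ·ₘ 1π) ∥ₘ 1σ} {1σ ∩ₘ ((R ∩ₘ 1̄π) ·ₘ 1̄π)}
      (λ {a} p →
         let ((B , r , _) , lift A≐a) = ⊑1π⇒∥-elim {(R ∩ₘ 1̄π) ·ₘ 1π} {1σ} (·1π-⊑1π (R ∩ₘ 1̄π)) p in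
         lift A≐a
         , (B , r , (λ _ → ｛ a ｝) , (λ _ _ → lift (λ a≐∅ → proj₁ a≐∅ refl))
           , ≐-trans A≐a (≐-sym (⋃∈-const (inhabited (lower (proj₂ r)))))))
      (λ { (lift A≐a , (B , r , _)) →
             ∥-intro-∅ {(R ∩ₘ 1̄π) ·ₘ 1π} {1σ} (·1π-intro {R ∩ₘ 1̄π} r) (lift A≐a) })

    ∩1̄π-·1π-∥-1̄π : ∀ R → (((R ∩ₘ 1̄π) ·ₘ 1π) ∥ₘ 1̄π) ≈ ((R ∩ₘ 1̄π) ·ₘ 1̄π)
    ∩1̄π-·1π-∥-1̄π R = ⊑-antisym {((R ∩ₘ 1̄π) ·ₘ 1π) ∥ₘ 1̄π} {(R ∩ₘ 1̄π) ·ₘ 1̄π}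
      (λ p →
         let ((B , r , _) , A≉∅) = ⊑1π⇒∥-elim {(R ∩ₘ 1̄π) ·ₘ 1π} {1̄π} (·1π-⊑1π (R ∩ₘ 1̄π)) p in
         B , r , (λ _ → _) , (λ _ _ → A≉∅) , ≐-sym (⋃∈-const (inhabited (lower (proj₂ r)))))
      (λ { (B , r , f , h , A≐⋃) →
             let (b , b∈B) = inhabited (lower (proj₂ r))
                 (x , x∈fb) = inhabited (lower (h b b∈B)) in
             ∥-intro-∅ {(R ∩ₘ 1̄π) ·ₘ 1π} {1̄π} (·1π-intro {R ∩ₘ 1̄π} r)
               (lift (λ A≐∅ → proj₁ A≐∅ (proj₂ A≐⋃ (b , b∈B , x∈fb)))) })

    isCLattice : IsCLattice _≈_ _∪ₘ_ _∩ₘ_ _·ₘ_ _∥ₘ_ ∅ₘ 1σ 1π Uₘ 1̄π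
    isCLattice = record
      { isDistributiveLattice = ∪ₘ-∩ₘ-isDistributiveLattice
      ; 0-least = λ R → ⊑⇒≤ {∅ₘ} {R} (λ { (lift ()) })
      ; U-greatest = λ R → ⊑⇒≤ {R} {Uₘ} (λ _ → lift tt)
      ; isProtoTrioid = ∪ₘ-∥ₘ-isProtoTrioid
      ; cl1 = ·1π-∪-·1̄π
      ; cl2 = 1π-∩-∪-1̄π
      ; cl3 = λ R S T → ⊑⇒≤ {R ·ₘ (S ∥ₘ T)} {(R ·ₘ S) ∥ₘ (R ·ₘ T)} (·-subdistribˡ-∥ R S T)
      ; cl4 = λ R S Z Z∥Z≤Z → ·-distribʳ-∥ R S Z (∥-self≤⇒∪-closed Z Z∥Z≤Z)
      ; cl5 = λ R S T → ⊑1π⇒·-assoc {T ·ₘ ∅ₘ} (·-⊑1π {T} {∅ₘ} (λ { (lift ()) })) R S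
      ; cl6 = ·∅ₘ-·-assoc
      ; cl7 = 1σ-∥-idem
      ; cl8 = λ R → ⊑1π⇒∥1σ-· {R ·ₘ 1π} (·1π-⊑1π R)
      ; cl9 = ∩1σ-·1π-∥-1σ
      ; cl10 = ∩1̄π-·1π-∥-1σ
      ; cl11 = ∩1̄π-·1π-∥-1̄π }

proposition21 : ExcludedMiddle 0ℓ → ExcludedMiddle (lsuc 0ℓ) →
    (X : Set) →
    IsCLattice (Multirel._≈_ X)
      (Multirel._∪ₘ_ X) (Multirel._∩ₘ_ X) (Multirel._·ₘ_ X) (Multirel._∥ₘ_ X)
      (Multirel.∅ₘ X) (Multirel.1σ X) (Multirel.1π X) (Multirel.Uₘ X) (Multirel.1̄π X)
-- Excluded middle for propositions in Set suffices.
proposition21 em _ X = MultirelationAlgebra.isCLattice X em
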